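{- Let $C(t)=\sum_{n\geq0}C_nt^n=\frac{1-\sqrt{1-4t}}{2t}$ be the generating function of the Catalan numbers. Then \[\sum_{n\geq1}|\hat{\mathcal{B}}_n(213)|\,t^n = t\,C(t)=\frac{1-\sqrt{1-4t}}{2}.\] Therefore $|\hat{\mathcal{B}}_n(213)|=C_{n-1}$ for $n\geq 1$.
   Context: An endofunction of size $n$ is a word $x=x_1\cdots x_n$ with entries in $\{1,\dots,n\}$; it is a Cayley permutation if it contains every integer between $1$ and $\max(x)$. Let $\mathrm{Ascbot}(x)=\{1\}\cup\{i:1\leq i\leq n-1,\ x_i<x_{i+1}\}$ and $\mathrm{Nub}(x)$ the set of indices $i$ such that $x_i$ is the leftmost occurrence of its value. A revised ascent sequence of length $n$ is a Cayley permutation $x$ of length $n$ with $\mathrm{Ascbot}(x)=\mathrm{Nub}(x)$. For Cayley permutations $x$ and $\sigma=\sigma_1\cdots\sigma_k$, $x$ contains $\sigma$ if there are indices $i_1<\cdots<i_k$ such that for all $s,t$: $x_{i_s}<x_{i_t}\iff\sigma_s<\sigma_t$ and $x_{i_s}=x_{i_t}\iff\sigma_s=\sigma_t$; otherwise $x$ avoids $\sigma$. $\hat{\mathcal{B}}_n(\sigma)$ is the set of revised ascent sequences of length $n$ avoiding $\sigma$. -}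

module Defs where

open import Data.Nat using (ℕ; zero; suc; _+_; _*_; _<ᵇ_; _≡ᵇ_; _∸_)
open import Data.Bool using (Bool; true; false; _∧_; _∨_; not; if_then_else_)
open import Data.Nat.ListAction using (sum)
open import Data.List using (List; []; _∷_; map; concatMap; filter; length; upTo; zipWith; reverse; _++_)
open import Data.Bool.Properties using (T?)
open import Data.Bool using (T)

allᵇ : {A : Set} → (A → Bool) → List A → Bool
allᵇ p [] = true
allᵇ p (x ∷ xs) = p x ∧ allᵇ p xs

anyᵇ : {A : Set} → (A → Bool) → List A → Bool
anyᵇ p [] = false
anyᵇ p (x ∷ xs) = p x ∨ anyᵇ p xs

-- Words are lists of naturals (positions are 1-indexed in the paper; here 0-indexed).

words : ℕ → ℕ → List (List ℕ)
words m zero = [] ∷ []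
words m (suc k) = concatMap (λ a → map (a ∷_) (words m k)) (map suc (upTo m))

endofunctions : ℕ → List (List ℕ)
endofunctions n = words n n

maxL : List ℕ → ℕ
maxL [] = 0
maxL (x ∷ xs) = Data.Nat._⊔_ x (maxL xs)

elemᵇ : ℕ → List ℕ → Bool
elemᵇ a xs = anyᵇ (λ y → a ≡ᵇ y) xs

isCayley : List ℕ → Bool
isCayley x = allᵇ (λ v → elemᵇ v x) (map suc (upTo (maxL x)))

-- indexed access (0-based), default 0
_!_ : List ℕ → ℕ → ℕ
[] ! _ = 0
(x ∷ xs) ! zero = x
(x ∷ xs) ! suc i = xs ! i

take : ℕ → List ℕ → List ℕ
take zero _ = []
take (suc k) [] = []
take (suc k) (x ∷ xs) = x ∷ take k xs

-- Ascbot (paper, 1-based): {1} ∪ {i : 1 ≤ i ≤ n-1, x_i < x_{i+1}}.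
-- Here positions are 0-based: {0} ∪ {i : 0 ≤ i ≤ n-2, x_i < x_{i+1}}.
inAscbot : List ℕ → ℕ → Bool
inAscbot x zero = true
inAscbot x (suc i) = (suc (suc i) <ᵇ suc (length x)) ∧ ((x ! suc i) <ᵇ (x ! suc (suc i)))

inNub : List ℕ → ℕ → Bool
inNub x i = not (elemᵇ (x ! i) (take i x))

isRevisedAscent : List ℕ → Bool
isRevisedAscent x = isCayley x ∧ allᵇ (λ i → inAscbot x i ≡ᵇB inNub x i) (upTo (length x))
  where
  _≡ᵇB_ : Bool → Bool → Bool
  true ≡ᵇB b = b
  false ≡ᵇB b = not b

incSeqs : ℕ → ℕ → ℕ → List (List ℕ)
incSeqs zero s r = [] ∷ []
incSeqs (suc k) s zero = []
incSeqs (suc k) s (suc r) = map (s ∷_) (incSeqs k (suc s) r) ++ incSeqs (suc k) (suc s) r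

sameOrder : ℕ → ℕ → ℕ → ℕ → Bool
sameOrder a b c d = ((a <ᵇ b) ≡B (c <ᵇ d)) ∧ ((a ≡ᵇ b) ≡B (c ≡ᵇ d))
  where
  _≡B_ : Bool → Bool → Bool
  true ≡B b = b
  false ≡B b = not b

contains : List ℕ → List ℕ → Bool
contains x σ = anyᵇ occ (incSeqs (length σ) 0 (length x))
  where
  k = length σ
  occ : List ℕ → Bool
  occ is = allᵇ (λ s → allᵇ (λ t → sameOrder (x ! (is ! s)) (x ! (is ! t)) (σ ! s) (σ ! t)) (upTo k)) (upTo k)

avoids : List ℕ → List ℕ → Bool
avoids x σ = not (contains x σ)

countB : ℕ → List ℕ → ℕ
countB n σ = length (filter (λ x → T? (isRevisedAscent x ∧ avoids x σ)) (endofunctions n))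

-- Catalan numbers C_n, the coefficients of C(t) = (1 - √(1-4t))/(2t),
-- i.e. of the unique power series with C = 1 + t C²:
-- C₀ = 1, C_{m+1} = Σ_{i=0}^{m} C_i C_{m-i}.
-- catalans m = [C_m, C_{m-1}, …, C_0]
catalans : ℕ → List ℕ
catalans zero = 1 ∷ []
catalans (suc m) = sum (zipWith _*_ cs (reverse cs)) ∷ cs
  where cs = catalans m

catalan : ℕ → ℕ
catalan m = head (catalans m)
  where
  head : List ℕ → ℕ
  head [] = 0
  head (c ∷ _) = c

-- Every word x of B̂(213) starts with its maximum x₀: an entry occurring for the
-- first time is followed by a larger one, so every ascending run ends at a value
-- seen before.  For x = x₀ x₁ r either x₁ = x₀, or x₁ < x₀ is new; then r = u v
-- with u the maximal run of entries above x₁, and 213-avoidance (x₁ playing the 2)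
-- keeps v weakly below x₁.  Sending x to (1 , x₁ r) in the first case and to
-- ((x₀ − x₁)(u − x₁) , x₁ v) in the second is a bijection from B̂_{m+2}(213) onto
-- the pairs (a , b) of words of B̂(213) with |a| + |b| = m + 2, so the numbers
-- |B̂_{n+1}(213)| satisfy the Catalan recurrence.
module Submission where

open import Defs
open import Data.Bool using (Bool; true; false; T; not; _∧_)
open import Data.Bool.Properties using (T-∧; T-∨; T-≡; T-not-≡; ¬-not; T?)
open import Data.Empty using (⊥; ⊥-elim)
open import Data.List
  using (List; []; _∷_; _++_; [_]; map; length; head; reverse; zipWith; concatMap; filter; cartesianProduct;
         takeWhile; dropWhile; upTo; applyUpTo; downFrom; applyDownFrom)
open import Data.List.Properties
  using (++-assoc; ++-identityʳ; ∷-injectiveˡ; ∷-injectiveʳ; map-∘; map-cong; map-id-local; length-++;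
         length-map; takeWhile++dropWhile; map-downFrom; map-applyUpTo; reverse-applyDownFrom)
open import Data.List.Membership.Propositional using (_∈_; _∉_; find; lose)
open import Data.List.Membership.Propositional.Properties
  using (∈-map⁺; ∈-map⁻; ∈-concatMap⁺; ∈-concatMap⁻; ∈-upTo⁺; ∈-upTo⁻; ∈-filter⁺; ∈-filter⁻;
         ∈-cartesianProduct⁺; ∈-cartesianProduct⁻)
open import Data.List.Membership.Propositional.Properties.WithK using (unique∧set⇒bag)
open import Data.List.Relation.Binary.BagAndSetEquality using (∼bag⇒↭)
open import Data.List.Relation.Binary.Disjoint.Propositional using (Disjoint)
open import Data.List.Relation.Binary.Permutation.Propositional.Properties using (↭-length)
open import Data.List.Relation.Unary.All as All using (All; []; _∷_)
import Data.List.Relation.Unary.All.Properties as All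
open import Data.List.Relation.Unary.AllPairs as AllPairs using ([]; _∷_)
import Data.List.Relation.Unary.AllPairs.Properties as AllPairs
open import Data.List.Relation.Unary.Any as Any using (Any; here; there)
import Data.List.Relation.Unary.Any.Properties as Any
open import Data.List.Relation.Unary.Unique.Propositional using (Unique)
import Data.List.Relation.Unary.Unique.Propositional.Properties as Unique
import Data.Maybe.Relation.Unary.All as Maybe
open import Data.Nat
  using (ℕ; zero; suc; _+_; _*_; _∸_; _≤_; _<_; _<ᵇ_; _≡ᵇ_; z≤n; s≤s; z<s; s<s; _≟_; _<?_)
open import Data.Nat.ListAction using (sum)
open import Data.Nat.Properties
open import Data.List.Membership.DecPropositional _≟_ using (_∈?_)
open import Data.Product using (∃; _×_; _,_; proj₁; proj₂; uncurry)
open import Data.Sum using (_⊎_; inj₁; inj₂; [_,_]′)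
open import Data.Unit using (⊤; tt)
open import Function using (_∘_; case_of_; _⇔_; mk⇔; Equivalence)
open import Function.Construct.Composition using (_⇔-∘_)
open import Function.Construct.Symmetry using (⇔-sym)
open import Function.Related.TypeIsomorphisms using (¬-cong-⇔)
open import Relation.Binary.Definitions using (tri<; tri≈; tri>)
open import Relation.Binary.PropositionalEquality
  using (_≡_; _≢_; refl; sym; trans; cong; cong₂; subst; module ≡-Reasoning)
open import Relation.Nullary using (¬_; yes; no)
open import Relation.Nullary.Decidable using (dec-true; dec-false)
open import Relation.Unary using (Decidable; ∁)

open Equivalence using (to; from)

private
  variable
    A : Set
    p : A → Bool
    xs : List A


allᵇ⁺ : All (T ∘ p) xs → T (allᵇ p xs)
allᵇ⁺ []         = tt
allᵇ⁺ (px ∷ pxs) = from T-∧ (px , allᵇ⁺ pxs)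

allᵇ⁻ : ∀ (xs : List A) → T (allᵇ p xs) → All (T ∘ p) xs
allᵇ⁻ []       _ = []
allᵇ⁻ (x ∷ xs) t = proj₁ (to T-∧ t) ∷ allᵇ⁻ xs (proj₂ (to T-∧ t))

allᵇ-false⁻ : ∀ (xs : List A) → allᵇ p xs ≡ false → Any (λ x → p x ≡ false) xs
allᵇ-false⁻ {p = p} (x ∷ xs) e with p x in px
... | false = here px
... | true  = there (allᵇ-false⁻ xs e)

anyᵇ⁺ : Any (T ∘ p) xs → T (anyᵇ p xs)
anyᵇ⁺ (here px)   = from T-∨ (inj₁ px)
anyᵇ⁺ (there pxs) = from T-∨ (inj₂ (anyᵇ⁺ pxs))

anyᵇ⁻ : ∀ (xs : List A) → T (anyᵇ p xs) → Any (T ∘ p) xs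
anyᵇ⁻ (x ∷ xs) t = [ here , there ∘ anyᵇ⁻ xs ]′ (to T-∨ t)

elemᵇ⁺ : ∀ {v} {vs : List ℕ} → v ∈ vs → T (elemᵇ v vs)
elemᵇ⁺ {v} = anyᵇ⁺ ∘ Any.map (λ { refl → ≡⇒≡ᵇ v v refl })

elemᵇ⁻ : ∀ {v} (vs : List ℕ) → T (elemᵇ v vs) → v ∈ vs
elemᵇ⁻ vs = Any.map (≡ᵇ⇒≡ _ _) ∘ anyᵇ⁻ vs

≡-not-elemᵇ : ∀ {a v} (vs : List ℕ) → a ≡ not (elemᵇ v vs) ⇔ (v ∉ vs ⇔ T a)
≡-not-elemᵇ {a} {v} vs with elemᵇ v vs in e | a
... | true  | true  = mk⇔ (λ ()) (λ h → ⊥-elim (from h tt (elemᵇ⁻ vs (from T-≡ e))))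
... | true  | false = mk⇔ (λ _ → mk⇔ (λ v∉vs → v∉vs (elemᵇ⁻ vs (from T-≡ e))) (λ ())) (λ _ → refl)
... | false | true  = mk⇔ (λ _ → mk⇔ _ (λ _ → subst T e ∘ elemᵇ⁺)) (λ _ → refl)
... | false | false = mk⇔ (λ ()) (λ h → ⊥-elim (to h (subst T e ∘ elemᵇ⁺)))

∧-false⇒false : ∀ {a b} → T a → a ∧ b ≡ false → b ≡ false
∧-false⇒false {true} _ e = e

¬T⇒≡false : ∀ {b} → ¬ T b → b ≡ false
¬T⇒≡false ¬b = ¬-not (¬b ∘ from T-≡)

<ᵇ-true : ∀ {m n} → m < n → (m <ᵇ n) ≡ true
<ᵇ-true = to T-≡ ∘ <⇒<ᵇ

<ᵇ-false : ∀ {m n} → n ≤ m → (m <ᵇ n) ≡ false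
<ᵇ-false {m} {n} n≤m = ¬T⇒≡false (≤⇒≯ n≤m ∘ <ᵇ⇒< m n)

≡ᵇ-true : ∀ m → (m ≡ᵇ m) ≡ true
≡ᵇ-true m = to T-≡ (≡⇒≡ᵇ m m refl)

≡ᵇ-false : ∀ {m n} → m ≢ n → (m ≡ᵇ n) ≡ false
≡ᵇ-false {m} {n} m≢n = ¬T⇒≡false (m≢n ∘ ≡ᵇ⇒≡ m n)


All-head : ∀ {P : A → Set} {xs} → All P xs → Maybe.All P (head xs)
All-head []       = Maybe.nothing
All-head (px ∷ _) = Maybe.just px

All-!⁻ : ∀ {P : ℕ → Set} ys → All P ys → ∀ {k} → k < length ys → P (ys ! k)
All-!⁻ (y ∷ ys) (py ∷ _)   {zero}  _         = py
All-!⁻ (y ∷ ys) (_ ∷ pys) {suc k} (s<s k<n) = All-!⁻ ys pys k<n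

All-!⁺ : ∀ {P : ℕ → Set} ys → (∀ {k} → k < length ys → P (ys ! k)) → All P ys
All-!⁺ []       _ = []
All-!⁺ (y ∷ ys) p = p z<s ∷ All-!⁺ ys (p ∘ s<s)

∈-snoc⁻ : ∀ {w y} (s : List ℕ) → w ∈ s ++ [ y ] → w ∈ s ⊎ w ≡ y
∈-snoc⁻ s w∈ with Any.++⁻ s w∈
... | inj₁ w∈s        = inj₁ w∈s
... | inj₂ (here w≡y) = inj₂ w≡y

∈-snoc-cong : ∀ {w y} (s s′ : List ℕ) → (w ∈ s → w ∈ s′) → w ∈ s ++ [ y ] → w ∈ s′ ++ [ y ]
∈-snoc-cong s s′ f w∈ with ∈-snoc⁻ s w∈
... | inj₁ w∈s  = Any.++⁺ˡ (f w∈s)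
... | inj₂ refl = Any.++⁺ʳ s′ (here refl)

module _ {P : ℕ → Set} (P? : Decidable P) where

  takeWhile-++ : ∀ {u v} → All P u → Maybe.All (∁ P) (head v) → takeWhile P? (u ++ v) ≡ u
  takeWhile-++ {[]}    {[]}    []         _              = refl
  takeWhile-++ {[]}    {y ∷ v} []         (Maybe.just ¬py) rewrite dec-false (P? y) ¬py = refl
  takeWhile-++ {y ∷ u}         (py ∷ pu) h rewrite dec-true (P? y) py = cong (y ∷_) (takeWhile-++ pu h)

  dropWhile-++ : ∀ {u v} → All P u → Maybe.All (∁ P) (head v) → dropWhile P? (u ++ v) ≡ v
  dropWhile-++ {[]}    {[]}    []         _              = refl
  dropWhile-++ {[]}    {y ∷ v} []         (Maybe.just ¬py) rewrite dec-false (P? y) ¬py = refl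
  dropWhile-++ {y ∷ u}         (py ∷ pu) h rewrite dec-true (P? y) py = dropWhile-++ pu h

Unique-concatMap : ∀ {A B : Set} (f : A → List B) {xs} → Unique xs → (∀ a → Unique (f a)) →
                   (∀ {a a′} → a ≢ a′ → Disjoint (f a) (f a′)) → Unique (concatMap f xs)
Unique-concatMap f {xs} xs! f! disjoint =
  Unique.concat⁺ (All.map⁺ (All.universal f! xs)) (AllPairs.map⁺ (AllPairs.map disjoint xs!))

length-bijection : ∀ {A B : Set} (f : A → B) (g : B → A) {xs : List A} {ys : List B} →
                   Unique xs → Unique ys → All (λ x → g (f x) ≡ x) xs →
                   (∀ {y} → y ∈ ys ⇔ y ∈ map f xs) → length ys ≡ length xs
length-bijection f g {xs} {ys} xs! ys! g∘f same =
  trans (↭-length (∼bag⇒↭ (unique∧set⇒bag ys! fxs! same))) (length-map f xs)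
  where
  fxs! : Unique (map f xs)
  fxs! = Unique.map⁻ {f = g} (subst Unique (sym (trans (sym (map-∘ xs)) (map-id-local g∘f))) xs!)

length-concatMap : ∀ {A B : Set} (f : A → List B) xs →
                   length (concatMap f xs) ≡ sum (map (length ∘ f) xs)
length-concatMap f []       = refl
length-concatMap f (x ∷ xs) = trans (length-++ (f x)) (cong (length (f x) +_) (length-concatMap f xs))

length-cartesianProduct : ∀ {A B : Set} (xs : List A) (ys : List B) →
                          length (cartesianProduct xs ys) ≡ length xs * length ys
length-cartesianProduct []       ys = refl
length-cartesianProduct (x ∷ xs) ys =
  trans (length-++ (map (x ,_) ys)) (cong₂ _+_ (length-map (x ,_) ys) (length-cartesianProduct xs ys))

applyDownFrom-suc : ∀ (f : ℕ → ℕ) n → applyDownFrom f (suc n) ≡ applyUpTo (λ i → f (n ∸ i)) (suc n)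
applyDownFrom-suc f zero    = refl
applyDownFrom-suc f (suc n) = cong (f (suc n) ∷_) (applyDownFrom-suc f n)

zipWith-applyUpTo : ∀ (_⊕_ : ℕ → ℕ → ℕ) f g n →
                    zipWith _⊕_ (applyUpTo f n) (applyUpTo g n) ≡ applyUpTo (λ i → f i ⊕ g i) n
zipWith-applyUpTo _⊕_ f g zero    = refl
zipWith-applyUpTo _⊕_ f g (suc n) = cong (f 0 ⊕ g 0 ∷_) (zipWith-applyUpTo _⊕_ (f ∘ suc) (g ∘ suc) n)


-- Revised ascent sequences

Ascends : ℕ → List ℕ → Set
Ascends y []      = ⊥
Ascends y (z ∷ _) = y < z

T-ascends : ∀ y ys → T (y <ᵇ ys ! 0) ⇔ Ascends y ys
T-ascends y []      = mk⇔ (λ ()) (λ ())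
T-ascends y (z ∷ _) = mk⇔ (<ᵇ⇒< y z) <⇒<ᵇ

¬ascends-≤ : ∀ {c} ys → All (_≤ c) ys → ¬ Ascends c ys
¬ascends-≤ (y ∷ _) (y≤c ∷ _) c<y = <⇒≱ c<y y≤c

-- `RevAsc s ys`: in the word s ++ ys, each position of ys is in Nub (its entry is
-- new) iff it is in Ascbot (its entry is followed by a larger one).
RevAsc : List ℕ → List ℕ → Set
RevAsc s []       = ⊤
RevAsc s (y ∷ ys) = (y ∉ s ⇔ Ascends y ys) × RevAsc (s ++ [ y ]) ys

-- `RevAsc` by positions, in the form checked by `isRevisedAscent`.
RevAscIndexed : List ℕ → List ℕ → Set
RevAscIndexed s xs = ∀ {i} → i < length xs →
  (xs ! i <ᵇ xs ! suc i) ≡ not (elemᵇ (xs ! i) (s ++ take i xs))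

RevAscIndexed⇒RevAsc : ∀ s xs → RevAscIndexed s xs → RevAsc s xs
RevAscIndexed⇒RevAsc s []       _   = tt
RevAscIndexed⇒RevAsc s (y ∷ ys) idx = nub⇔asc , RevAscIndexed⇒RevAsc (s ++ [ y ]) ys idx′
  where
  nub⇔asc : y ∉ s ⇔ Ascends y ys
  nub⇔asc = T-ascends y ys ⇔-∘ to (≡-not-elemᵇ s)
              (subst (λ c → _ ≡ not (elemᵇ y c)) (++-identityʳ s) (idx z<s))
  idx′ : RevAscIndexed (s ++ [ y ]) ys
  idx′ {i} i<n rewrite ++-assoc s [ y ] (take i ys) = idx (s<s i<n)

RevAsc⇒RevAscIndexed : ∀ s xs → RevAsc s xs → RevAscIndexed s xs
RevAsc⇒RevAscIndexed s (y ∷ ys) (nub⇔asc , _) {zero} _ rewrite ++-identityʳ s =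
  from (≡-not-elemᵇ s) (⇔-sym (T-ascends y ys) ⇔-∘ nub⇔asc)
RevAsc⇒RevAscIndexed s (y ∷ ys) (_ , rest) {suc i} (s<s i<n)
  rewrite sym (++-assoc s [ y ] (take i ys)) = RevAsc⇒RevAscIndexed (s ++ [ y ]) ys rest i<n

isRevisedAscent⁻ : ∀ x₀ xs → T (isRevisedAscent (x₀ ∷ xs)) → ∀ {i} → i < length xs →
                   inAscbot (x₀ ∷ xs) (suc i) ≡ inNub (x₀ ∷ xs) (suc i)
isRevisedAscent⁻ x₀ xs t {i} i<n
  with inAscbot (x₀ ∷ xs) (suc i) | inNub (x₀ ∷ xs) (suc i)
     | All.applyUpTo⁻ suc (length xs)
         (allᵇ⁻ (applyUpTo suc (length xs)) (proj₂ (to (T-∧ {isCayley (x₀ ∷ xs)}) t))) i<n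
... | true  | true  | _ = refl
... | false | false | _ = refl

-- The Boolean equality that `isRevisedAscent` compares Ascbot and Nub with is local
-- to its definition, so it is only reachable by with-abstraction at a failing index.
isRevisedAscent⁺ : ∀ x₀ xs → T (isCayley (x₀ ∷ xs)) →
                   (∀ {i} → i < length xs → inAscbot (x₀ ∷ xs) (suc i) ≡ inNub (x₀ ∷ xs) (suc i)) →
                   T (isRevisedAscent (x₀ ∷ xs))
isRevisedAscent⁺ x₀ xs c agree with isRevisedAscent (x₀ ∷ xs) in e
... | true  = tt
... | false with Any.applyUpTo⁻ suc
                  (allᵇ-false⁻ (applyUpTo suc (length xs)) (∧-false⇒false {isCayley (x₀ ∷ xs)} c e))
... | i , i<n , fails with inAscbot (x₀ ∷ xs) (suc i) | inNub (x₀ ∷ xs) (suc i) | agree i<n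
... | true  | .true  | refl = case fails of λ ()
... | false | .false | refl = case fails of λ ()

inAscbot-suc : ∀ x₀ xs {i} → i < length xs → inAscbot (x₀ ∷ xs) (suc i) ≡ (xs ! i <ᵇ xs ! suc i)
inAscbot-suc x₀ xs i<n rewrite to T-≡ (<⇒<ᵇ i<n) = refl

-- Every entry is bounded by an entry of the context: a new entry ascends, and
-- the ascending run it starts ends at an entry that is not new.
head-bounded : ∀ s y ys → (y ∉ s → Ascends y ys) → All (λ z → Any (z ≤_) (s ++ [ y ])) ys →
               Any (y ≤_) s
head-bounded s y ys asc bounded with y ∈? s
head-bounded s y ys       asc bounded       | yes y∈s = Any.map ≤-reflexive y∈s
head-bounded s y []       asc []            | no y∉s  = ⊥-elim (asc y∉s)
head-bounded s y (z ∷ zs) asc (z≤ ∷ _)      | no y∉s with Any.++⁻ s z≤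
... | inj₁ z≤s        = Any.map (≤-trans (<⇒≤ (asc y∉s))) z≤s
... | inj₂ (here z≤y) = ⊥-elim (<⇒≱ (asc y∉s) z≤y)

RevAsc⇒bounded : ∀ s ys → RevAsc s ys → All (λ y → Any (y ≤_) s) ys
RevAsc⇒bounded s []       _                 = []
RevAsc⇒bounded s (y ∷ ys) (nub⇔asc , rest) = y≤s ∷ All.map shrink bounded
  where
  bounded : All (λ z → Any (z ≤_) (s ++ [ y ])) ys
  bounded = RevAsc⇒bounded (s ++ [ y ]) ys rest
  y≤s : Any (y ≤_) s
  y≤s = head-bounded s y ys (to nub⇔asc) bounded
  shrink : ∀ {z} → Any (z ≤_) (s ++ [ y ]) → Any (z ≤_) s
  shrink z≤ with Any.++⁻ s z≤
  ... | inj₁ z≤s        = z≤s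
  ... | inj₂ (here z≤y) = Any.map (≤-trans z≤y) y≤s

RevAsc⇒≤head : ∀ x₀ ys → RevAsc [ x₀ ] ys → All (_≤ x₀) ys
RevAsc⇒≤head x₀ ys ra = All.map (λ { (here z≤x₀) → z≤x₀ }) (RevAsc⇒bounded [ x₀ ] ys ra)

maxL-head : ∀ x₀ xs → All (_≤ x₀) xs → maxL (x₀ ∷ xs) ≡ x₀
maxL-head x₀ xs xs≤x₀ = m≥n⇒m⊔n≡m (maxL-≤ xs≤x₀)
  where
  maxL-≤ : ∀ {m ys} → All (_≤ m) ys → maxL ys ≤ m
  maxL-≤ []            = z≤n
  maxL-≤ (y≤m ∷ ys≤m) = ⊔-lub y≤m (maxL-≤ ys≤m)

Covers : ℕ → List ℕ → Set
Covers m x = ∀ {i} → i < m → suc i ∈ x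

T-isCayley : ∀ x → T (isCayley x) ⇔ Covers (maxL x) x
T-isCayley x = mk⇔
  (λ t {i} i<m → elemᵇ⁻ x (All.applyUpTo⁻ (λ i → i) (maxL x) (All.map⁻ (allᵇ⁻ _ t)) i<m))
  (λ covers → allᵇ⁺ (All.map⁺ (All.applyUpTo⁺₁ (λ i → i) (maxL x) λ {i} i<m → elemᵇ⁺ (covers {i} i<m))))

T-isRevisedAscent : ∀ x₀ xs → T (isRevisedAscent (x₀ ∷ xs)) ⇔
                    (RevAsc [ x₀ ] xs × Covers x₀ (x₀ ∷ xs))
T-isRevisedAscent x₀ xs = mk⇔ sound complete
  where
  max≡x₀ : RevAsc [ x₀ ] xs → maxL (x₀ ∷ xs) ≡ x₀
  max≡x₀ ra = maxL-head x₀ xs (RevAsc⇒≤head x₀ xs ra)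
  sound : T (isRevisedAscent (x₀ ∷ xs)) → RevAsc [ x₀ ] xs × Covers x₀ (x₀ ∷ xs)
  sound t = ra , subst (λ m → Covers m (x₀ ∷ xs)) (max≡x₀ ra) cayley
    where
    ra : RevAsc [ x₀ ] xs
    ra = RevAscIndexed⇒RevAsc [ x₀ ] xs λ i<n →
           trans (sym (inAscbot-suc x₀ xs i<n)) (isRevisedAscent⁻ x₀ xs t i<n)
    cayley : Covers (maxL (x₀ ∷ xs)) (x₀ ∷ xs)
    cayley = to (T-isCayley (x₀ ∷ xs)) (proj₁ (to (T-∧ {isCayley (x₀ ∷ xs)}) t))
  complete : RevAsc [ x₀ ] xs × Covers x₀ (x₀ ∷ xs) → T (isRevisedAscent (x₀ ∷ xs))
  complete (ra , covers) = isRevisedAscent⁺ x₀ xs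
    (from (T-isCayley (x₀ ∷ xs)) (subst (λ m → Covers m (x₀ ∷ xs)) (sym (max≡x₀ ra)) covers))
    (λ i<n → trans (inAscbot-suc x₀ xs i<n) (RevAsc⇒RevAscIndexed [ x₀ ] xs ra i<n))

RevAsc-cong : ∀ s s′ ys → (∀ {y} → y ∈ ys → y ∈ s ⇔ y ∈ s′) → RevAsc s ys → RevAsc s′ ys
RevAsc-cong s s′ []       _    _                 = tt
RevAsc-cong s s′ (y ∷ ys) same (nub⇔asc , rest) =
  nub⇔asc ⇔-∘ ¬-cong-⇔ (⇔-sym (same (here refl))) ,
  RevAsc-cong (s ++ [ y ]) (s′ ++ [ y ]) ys
    (λ z∈ → mk⇔ (∈-snoc-cong s s′ (to (same (there z∈)))) (∈-snoc-cong s′ s (from (same (there z∈)))))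
    rest

-- `RevAsc s u` when u is followed by v, so that the last entry of u may ascend into v.
RevAscBefore : List ℕ → List ℕ → List ℕ → Set
RevAscBefore s []      v = ⊤
RevAscBefore s (y ∷ u) v = (y ∉ s ⇔ Ascends y (u ++ v)) × RevAscBefore (s ++ [ y ]) u v

RevAsc-++⁻ : ∀ s u v → RevAsc s (u ++ v) → RevAscBefore s u v × RevAsc (s ++ u) v
RevAsc-++⁻ s []      v ra rewrite ++-identityʳ s = tt , ra
RevAsc-++⁻ s (y ∷ u) v (nub⇔asc , rest) with RevAsc-++⁻ (s ++ [ y ]) u v rest
... | before , after rewrite ++-assoc s [ y ] u = (nub⇔asc , before) , after

RevAsc-++⁺ : ∀ s u v → RevAscBefore s u v → RevAsc (s ++ u) v → RevAsc s (u ++ v)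
RevAsc-++⁺ s []      v _                    ra rewrite ++-identityʳ s = ra
RevAsc-++⁺ s (y ∷ u) v (nub⇔asc , before) ra =
  nub⇔asc , RevAsc-++⁺ (s ++ [ y ]) u v before (subst (λ c → RevAsc c v) (sym (++-assoc s [ y ] u)) ra)

ShiftedContext : ℕ → List ℕ → List ℕ → List ℕ → Set
ShiftedContext c s s′ w = ∀ {y} → y ∈ w → y + c ∈ s′ ⇔ y ∈ s

ShiftedContext-∷ : ∀ c s s′ y w → ShiftedContext c s s′ (y ∷ w) →
                   ShiftedContext c (s ++ [ y ]) (s′ ++ [ y + c ]) w
ShiftedContext-∷ c s s′ y w shifted {z} z∈w = mk⇔ down up
  where
  down : z + c ∈ s′ ++ [ y + c ] → z ∈ s ++ [ y ]
  down z+c∈ with ∈-snoc⁻ s′ z+c∈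
  ... | inj₁ z+c∈s′ = Any.++⁺ˡ (to (shifted (there z∈w)) z+c∈s′)
  ... | inj₂ z+c≡y+c rewrite +-cancelʳ-≡ c z y z+c≡y+c = Any.++⁺ʳ s (here refl)
  up : z ∈ s ++ [ y ] → z + c ∈ s′ ++ [ y + c ]
  up z∈ with ∈-snoc⁻ s z∈
  ... | inj₁ z∈s = Any.++⁺ˡ (from (shifted (there z∈w)) z∈s)
  ... | inj₂ refl = Any.++⁺ʳ s′ (here refl)

ascends-+ : ∀ c y w v → All (_≤ c) v → Ascends y w ⇔ Ascends (y + c) (map (_+ c) w ++ v)
ascends-+ c y []      []          _          = mk⇔ (λ ()) (λ ())
ascends-+ c y []      (z ∷ v)     (z≤c ∷ _) = mk⇔ (λ ()) (λ y+c<z → <⇒≱ y+c<z (≤-trans z≤c (m≤n+m c y)))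
ascends-+ c y (z ∷ w) v           _          = mk⇔ (+-monoˡ-< c) (+-cancelʳ-< c y z)

RevAsc-shift⁺ : ∀ c s s′ w v → All (_≤ c) v → ShiftedContext c s s′ w →
                RevAsc s w → RevAscBefore s′ (map (_+ c) w) v
RevAsc-shift⁺ c s s′ []      v _   _       _                 = tt
RevAsc-shift⁺ c s s′ (y ∷ w) v v≤c shifted (nub⇔asc , rest) =
  ascends-+ c y w v v≤c ⇔-∘ (nub⇔asc ⇔-∘ ¬-cong-⇔ (shifted (here refl))) ,
  RevAsc-shift⁺ c (s ++ [ y ]) (s′ ++ [ y + c ]) w v v≤c (ShiftedContext-∷ c s s′ y w shifted) rest

RevAsc-shift⁻ : ∀ c s s′ w v → All (_≤ c) v → ShiftedContext c s s′ w →
                RevAscBefore s′ (map (_+ c) w) v → RevAsc s w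
RevAsc-shift⁻ c s s′ []      v _   _       _                 = tt
RevAsc-shift⁻ c s s′ (y ∷ w) v v≤c shifted (nub⇔asc , rest) =
  ⇔-sym (ascends-+ c y w v v≤c) ⇔-∘ (nub⇔asc ⇔-∘ ¬-cong-⇔ (⇔-sym (shifted (here refl)))) ,
  RevAsc-shift⁻ c (s ++ [ y ]) (s′ ++ [ y + c ]) w v v≤c (ShiftedContext-∷ c s s′ y w shifted) rest


-- Avoiding 213

sameOrder-refl : ∀ a c → T (sameOrder a a c c)
sameOrder-refl a c
  rewrite <ᵇ-false (≤-refl {a}) | <ᵇ-false (≤-refl {c}) | ≡ᵇ-true a | ≡ᵇ-true c = tt

sameOrder-< : ∀ {a b c d} → a < b → c < d → T (sameOrder a b c d)
sameOrder-< a<b c<d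
  rewrite <ᵇ-true a<b | <ᵇ-true c<d | ≡ᵇ-false (<⇒≢ a<b) | ≡ᵇ-false (<⇒≢ c<d) = tt

sameOrder-> : ∀ {a b c d} → b < a → d < c → T (sameOrder a b c d)
sameOrder-> b<a d<c
  rewrite <ᵇ-false (<⇒≤ b<a) | <ᵇ-false (<⇒≤ d<c) | ≡ᵇ-false (>⇒≢ b<a) | ≡ᵇ-false (>⇒≢ d<c) = tt

sameOrder⇒< : ∀ a b {c d} → c < d → T (sameOrder a b c d) → a < b
sameOrder⇒< a b {c} {d} c<d t with c <ᵇ d | <ᵇ-true c<d | a <ᵇ b in a<ᵇb
... | .true | refl | true  = <ᵇ⇒< a b (from T-≡ a<ᵇb)
... | .true | refl | false = ⊥-elim t

Increasing : ℕ → ℕ → List ℕ → Set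
Increasing lo hi []       = ⊤
Increasing lo hi (v ∷ vs) = lo ≤ v × v < hi × Increasing (suc v) hi vs

∈-incSeqs⁻ : ∀ k s r {is} → is ∈ incSeqs k s r → length is ≡ k × Increasing s (s + r) is
∈-incSeqs⁻ zero    s r       (here refl) = refl , tt
∈-incSeqs⁻ (suc k) s (suc r) is∈ rewrite +-suc s r with Any.++⁻ (map (s ∷_) (incSeqs k (suc s) r)) is∈
... | inj₁ is∈ˡ with ∈-map⁻ (s ∷_) is∈ˡ
...   | is′ , is′∈ , refl with ∈-incSeqs⁻ k (suc s) r is′∈
...     | len , inc = cong suc len , ≤-refl , s≤s (m≤m+n s r) , inc
∈-incSeqs⁻ (suc k) s (suc r) is∈ | inj₂ is∈ʳ with ∈-incSeqs⁻ (suc k) (suc s) r is∈ʳ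
... | len , inc = len , weaken inc
  where
  weaken : ∀ {is} → Increasing (suc s) (suc s + r) is → Increasing s (suc s + r) is
  weaken {[]}    _                 = tt
  weaken {_ ∷ _} (s<v , v<hi , inc) = <⇒≤ s<v , v<hi , inc

∈-incSeqs⁺ : ∀ k s r {is} → length is ≡ k → Increasing s (s + r) is → is ∈ incSeqs k s r
∈-incSeqs⁺ zero    s r       {[]}     _   _                 = here refl
∈-incSeqs⁺ (suc k) s zero    {v ∷ is} _   (s≤v , v<s+0 , _) =
  ⊥-elim (<⇒≱ v<s+0 (subst (_≤ v) (sym (+-identityʳ s)) s≤v))
∈-incSeqs⁺ (suc k) s (suc r) {v ∷ is} len (s≤v , v<hi , inc) rewrite +-suc s r with s ≟ v
... | yes refl = Any.++⁺ˡ (∈-map⁺ (s ∷_) (∈-incSeqs⁺ k (suc s) r (suc-injective len) inc))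
... | no  s≢v  = Any.++⁺ʳ (map (s ∷_) (incSeqs k (suc s) r))
                   (∈-incSeqs⁺ (suc k) (suc s) r len (≤∧≢⇒< s≤v s≢v , v<hi , inc))

∈-incSeqs₃⁻ : ∀ {n is} → is ∈ incSeqs 3 0 n →
              ∃ λ i → ∃ λ j → ∃ λ k → is ≡ i ∷ j ∷ k ∷ [] × i < j × j < k × k < n
∈-incSeqs₃⁻ {n} is∈ with ∈-incSeqs⁻ 3 0 n is∈
... | len , inc = triple _ len inc
  where
  triple : ∀ is → length is ≡ 3 → Increasing 0 n is →
           ∃ λ i → ∃ λ j → ∃ λ k → is ≡ i ∷ j ∷ k ∷ [] × i < j × j < k × k < n
  triple (i ∷ j ∷ k ∷ []) refl (_ , _ , i<j , _ , j<k , k<n , _) = i , j , k , refl , i<j , j<k , k<n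

Occurs213 : List ℕ → Set
Occurs213 x = ∃ λ i → ∃ λ j → ∃ λ k →
  i < j × j < k × k < length x × x ! j < x ! i × x ! i < x ! k

-- The test applied by `contains x σ` to each increasing index list `is`
-- (local to the definition of `contains`).
orderIsoᵇ : List ℕ → List ℕ → List ℕ → Bool
orderIsoᵇ x σ is = allᵇ (λ s → allᵇ (sameOrderAt s) (upTo (length σ))) (upTo (length σ))
  where
  sameOrderAt : ℕ → ℕ → Bool
  sameOrderAt s t = sameOrder (x ! (is ! s)) (x ! (is ! t)) (σ ! s) (σ ! t)

OrderIso : List ℕ → List ℕ → List ℕ → Set
OrderIso x σ is = All (λ s → All (λ t → T (sameOrder (x ! (is ! s)) (x ! (is ! t)) (σ ! s) (σ ! t)))
                                 (upTo (length σ)))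
                      (upTo (length σ))

orderIsoᵇ⁻ : ∀ x σ is → T (orderIsoᵇ x σ is) → OrderIso x σ is
orderIsoᵇ⁻ x σ is = All.map (allᵇ⁻ (upTo (length σ))) ∘ allᵇ⁻ (upTo (length σ))

orderIsoᵇ⁺ : ∀ x σ is → OrderIso x σ is → T (orderIsoᵇ x σ is)
orderIsoᵇ⁺ x σ is = allᵇ⁺ ∘ All.map allᵇ⁺

contains213⇒ : ∀ x → T (contains x (2 ∷ 1 ∷ 3 ∷ [])) → Occurs213 x
contains213⇒ x t with find (anyᵇ⁻ {p = orderIsoᵇ x (2 ∷ 1 ∷ 3 ∷ [])} (incSeqs 3 0 (length x)) t)
... | is , is∈ , occ with ∈-incSeqs₃⁻ {length x} is∈
... | i , j , k , refl , i<j , j<k , k<n with orderIsoᵇ⁻ x (2 ∷ 1 ∷ 3 ∷ []) (i ∷ j ∷ k ∷ []) occ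
... | (_ ∷ _ ∷ xi~xk ∷ []) ∷ (xj~xi ∷ _) ∷ _ =
  i , j , k , i<j , j<k , k<n , sameOrder⇒< _ _ (n<1+n 1) xj~xi , sameOrder⇒< _ _ (n<1+n 2) xi~xk

⇒contains213 : ∀ x → Occurs213 x → T (contains x (2 ∷ 1 ∷ 3 ∷ []))
⇒contains213 x (i , j , k , i<j , j<k , k<n , xj<xi , xi<xk) =
  anyᵇ⁺ {p = orderIsoᵇ x (2 ∷ 1 ∷ 3 ∷ [])}
    (lose (∈-incSeqs⁺ 3 0 (length x) refl (z≤n , i<n , i<j , j<n , j<k , k<n , tt))
          (orderIsoᵇ⁺ x (2 ∷ 1 ∷ 3 ∷ []) (i ∷ j ∷ k ∷ [])
             ( (sameOrder-refl (x ! i) 2 ∷ sameOrder-> xj<xi 1<2 ∷ sameOrder-< xi<xk 2<3 ∷ [])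
             ∷ (sameOrder-< xj<xi 1<2 ∷ sameOrder-refl (x ! j) 1 ∷ sameOrder-< xj<xk 1<3 ∷ [])
             ∷ (sameOrder-> xi<xk 2<3 ∷ sameOrder-> xj<xk 1<3 ∷ sameOrder-refl (x ! k) 3 ∷ [])
             ∷ [])))
  where
  j<n : j < length x
  j<n = <-trans j<k k<n
  i<n : i < length x
  i<n = <-trans i<j j<n
  xj<xk : x ! j < x ! k
  xj<xk = <-trans xj<xi xi<xk
  1<2 : 1 < 2
  1<2 = n<1+n 1
  2<3 : 2 < 3
  2<3 = n<1+n 2
  1<3 : 1 < 3
  1<3 = <-trans 1<2 2<3

-- `No213At p ys`: no j < k has ys ! j < p < ys ! k, i.e. p placed in front of ys
-- is not the 2 of an occurrence of 213.
No213At : ℕ → List ℕ → Set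
No213At p []       = ⊤
No213At p (y ∷ ys) = (y < p → All (_≤ p) ys) × No213At p ys

Avoid213 : List ℕ → Set
Avoid213 []       = ⊤
Avoid213 (y ∷ ys) = No213At y ys × Avoid213 ys

No213At⇒ : ∀ p ys → No213At p ys → ∀ {j k} → j < k → k < length ys → ys ! j < p → p < ys ! k → ⊥
No213At⇒ p (y ∷ ys) (y<p⇒ , _) {zero}  {suc k} _         (s<s k<n) y<p p<yk =
  <⇒≱ p<yk (All-!⁻ ys (y<p⇒ y<p) k<n)
No213At⇒ p (y ∷ ys) (_ , rest)  {suc j} {suc k} (s<s j<k) (s<s k<n) =
  No213At⇒ p ys rest j<k k<n

⇒No213At : ∀ p ys → (∀ {j k} → j < k → k < length ys → ys ! j < p → p < ys ! k → ⊥) → No213At p ys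
⇒No213At p []       _    = tt
⇒No213At p (y ∷ ys) none = bounded , ⇒No213At p ys (λ j<k k<n → none (s<s j<k) (s<s k<n))
  where
  bounded : y < p → All (_≤ p) ys
  bounded y<p = All-!⁺ ys λ k<n → ≮⇒≥ (none (s≤s z≤n) (s<s k<n) y<p)

Avoid213⇒¬Occurs213 : ∀ x → Avoid213 x → ¬ Occurs213 x
Avoid213⇒¬Occurs213 (y ∷ ys) (noAt , _) (zero , suc j , suc k , _ , s<s j<k , s<s k<n , yj<y , y<yk) =
  No213At⇒ y ys noAt j<k k<n yj<y y<yk
Avoid213⇒¬Occurs213 (y ∷ ys) (_ , av) (suc i , suc j , suc k , s<s i<j , s<s j<k , s<s k<n , occ) =
  Avoid213⇒¬Occurs213 ys av (i , j , k , i<j , j<k , k<n , occ)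

¬Occurs213⇒Avoid213 : ∀ x → ¬ Occurs213 x → Avoid213 x
¬Occurs213⇒Avoid213 []       _    = tt
¬Occurs213⇒Avoid213 (y ∷ ys) none =
  ⇒No213At y ys (λ j<k k<n yj<y y<yk → none (0 , _ , _ , s≤s z≤n , s<s j<k , s<s k<n , yj<y , y<yk)) ,
  ¬Occurs213⇒Avoid213 ys λ (i , j , k , i<j , j<k , k<n , occ) →
    none (suc i , suc j , suc k , s<s i<j , s<s j<k , s<s k<n , occ)

T-avoids213 : ∀ x → T (avoids x (2 ∷ 1 ∷ 3 ∷ [])) ⇔ Avoid213 x
T-avoids213 x = mk⇔
  (λ t → ¬Occurs213⇒Avoid213 x (λ occ → subst T (to T-not-≡ t) (⇒contains213 x occ)))
  (λ av → from T-not-≡ (¬T⇒≡false (Avoid213⇒¬Occurs213 x av ∘ contains213⇒ x)))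

No213At-≤ : ∀ p ys → All (_≤ p) ys → No213At p ys
No213At-≤ p []       _          = tt
No213At-≤ p (y ∷ ys) (_ ∷ ys≤p) = (λ _ → ys≤p) , No213At-≤ p ys ys≤p

No213At-≥ : ∀ p ys → All (p ≤_) ys → No213At p ys
No213At-≥ p []       _            = tt
No213At-≥ p (y ∷ ys) (p≤y ∷ p≤ys) = (λ y<p → ⊥-elim (<⇒≱ y<p p≤y)) , No213At-≥ p ys p≤ys

No213At-++ : ∀ p u v → No213At p u → All (_≤ p) v → No213At p (u ++ v)
No213At-++ p []      v _              v≤p = No213At-≤ p v v≤p
No213At-++ p (y ∷ u) v (y<p⇒ , no213) v≤p =
  (λ y<p → All.++⁺ (y<p⇒ y<p) v≤p) , No213At-++ p u v no213 v≤p

No213At-++⁻ˡ : ∀ p u v → No213At p (u ++ v) → No213At p u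
No213At-++⁻ˡ p []      v _              = tt
No213At-++⁻ˡ p (y ∷ u) v (y<p⇒ , no213) = (All.++⁻ˡ u ∘ y<p⇒) , No213At-++⁻ˡ p u v no213

No213At-++⁻ʳ : ∀ p u v → No213At p (u ++ v) → No213At p v
No213At-++⁻ʳ p []      v no213       = no213
No213At-++⁻ʳ p (y ∷ u) v (_ , no213) = No213At-++⁻ʳ p u v no213

Avoid213-++ : ∀ u v → Avoid213 u → Avoid213 v → All (λ y → All (_≤ y) v) u → Avoid213 (u ++ v)
Avoid213-++ []      v _             av _           = av
Avoid213-++ (y ∷ u) v (no213 , avu) av (v≤y ∷ v≤u) =
  No213At-++ y u v no213 v≤y , Avoid213-++ u v avu av v≤u

Avoid213-++⁻ˡ : ∀ u v → Avoid213 (u ++ v) → Avoid213 u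
Avoid213-++⁻ˡ []      v _            = tt
Avoid213-++⁻ˡ (y ∷ u) v (no213 , av) = No213At-++⁻ˡ y u v no213 , Avoid213-++⁻ˡ u v av

Avoid213-++⁻ʳ : ∀ u v → Avoid213 (u ++ v) → Avoid213 v
Avoid213-++⁻ʳ []      v av       = av
Avoid213-++⁻ʳ (y ∷ u) v (_ , av) = Avoid213-++⁻ʳ u v av

No213At-+⁺ : ∀ c p w → No213At p w → No213At (p + c) (map (_+ c) w)
No213At-+⁺ c p []      _              = tt
No213At-+⁺ c p (y ∷ w) (y<p⇒ , no213) =
  (λ y+c<p+c → All.map⁺ (All.map (+-monoˡ-≤ c) (y<p⇒ (+-cancelʳ-< c y p y+c<p+c)))) ,
  No213At-+⁺ c p w no213

No213At-+⁻ : ∀ c p w → No213At (p + c) (map (_+ c) w) → No213At p w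
No213At-+⁻ c p []      _              = tt
No213At-+⁻ c p (y ∷ w) (y<p⇒ , no213) =
  (λ y<p → All.map (λ {z} → +-cancelʳ-≤ c z p) (All.map⁻ (y<p⇒ (+-monoˡ-< c y<p)))) ,
  No213At-+⁻ c p w no213

Avoid213-+⁺ : ∀ c w → Avoid213 w → Avoid213 (map (_+ c) w)
Avoid213-+⁺ c []      _            = tt
Avoid213-+⁺ c (y ∷ w) (no213 , av) = No213At-+⁺ c y w no213 , Avoid213-+⁺ c w av

Avoid213-+⁻ : ∀ c w → Avoid213 (map (_+ c) w) → Avoid213 w
Avoid213-+⁻ c []      _            = tt
Avoid213-+⁻ c (y ∷ w) (no213 , av) = No213At-+⁻ c y w no213 , Avoid213-+⁻ c w av

-- If c has already occurred and does not ascend into v, then v stays weakly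
-- below c: its first entry y ≤ c; if y < c then 213-avoidance bounds the rest
-- by c, and if y = c the same situation repeats one step later.
RevAsc⇒below : ∀ c s v → c ∈ s → ¬ Ascends c v → No213At c v → RevAsc s v → All (_≤ c) v
RevAsc⇒below c s []      _   _      _                  _                    = []
RevAsc⇒below c s (y ∷ v) c∈s ¬c<y (y<c⇒ , no213) (nub⇔asc , rest) with <-cmp y c
... | tri< y<c _ _   = <⇒≤ y<c ∷ y<c⇒ y<c
... | tri> _ _ c<y   = ⊥-elim (¬c<y c<y)
... | tri≈ _ refl _  = ≤-refl ∷ RevAsc⇒below c (s ++ [ c ]) v (Any.++⁺ˡ c∈s)
                                  (λ c<v → from nub⇔asc c<v c∈s) no213 rest


-- The decomposition

-- x₀ ∷ xs ∈ B̂(213), except that the entries are not required to be at most the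
-- length; that follows (entries≤length).
record IsRevAsc213 (x₀ : ℕ) (xs : List ℕ) : Set where
  field
    positive : All (0 <_) (x₀ ∷ xs)
    covers   : Covers x₀ (x₀ ∷ xs)
    revAsc   : RevAsc [ x₀ ] xs
    avoid    : Avoid213 (x₀ ∷ xs)

  ≤head : All (_≤ x₀) xs
  ≤head = RevAsc⇒≤head x₀ xs revAsc

RevAsc213 : List ℕ → Set
RevAsc213 []        = ⊥
RevAsc213 (x₀ ∷ xs) = IsRevAsc213 x₀ xs

open IsRevAsc213

singleton≡1 : ∀ {a₀} → IsRevAsc213 a₀ [] → a₀ ≡ 1
singleton≡1 a with covers a (All.head (positive a))
... | here 1≡a₀ = sym 1≡a₀

one : IsRevAsc213 1 []
one = record
  { positive = s≤s z≤n ∷ []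
  ; covers   = λ { {zero} _ → here refl ; {suc _} (s≤s ()) }
  ; revAsc   = tt
  ; avoid    = tt , tt
  }

repeat-head : ∀ {b₀ bs} → IsRevAsc213 b₀ bs → IsRevAsc213 b₀ (b₀ ∷ bs)
repeat-head {b₀} {bs} b = record
  { positive = All.head (positive b) ∷ positive b
  ; covers   = there ∘ covers b
  ; revAsc   = mk⇔ (λ b₀∉ → ⊥-elim (b₀∉ (here refl))) (⊥-elim ∘ ¬ascends-≤ bs (≤head b)) ,
               RevAsc-cong [ b₀ ] (b₀ ∷ b₀ ∷ []) bs
                 (λ _ → mk⇔ (λ { (here refl) → here refl })
                            (λ { (here refl) → here refl ; (there (here refl)) → here refl }))
                 (revAsc b)
  ; avoid    = No213At-≤ b₀ (b₀ ∷ bs) (≤-refl ∷ ≤head b) , avoid b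
  }

drop-repeat : ∀ {x₀ r} → IsRevAsc213 x₀ (x₀ ∷ r) → IsRevAsc213 x₀ r
drop-repeat {x₀} {r} x = record
  { positive = All.head (positive x) ∷ All.tail (All.tail (positive x))
  ; covers   = λ i<x₀ → case covers x i<x₀ of λ
                 { (here e) → here e ; (there (here e)) → here e ; (there (there m)) → there m }
  ; revAsc   = RevAsc-cong (x₀ ∷ x₀ ∷ []) [ x₀ ] r
                 (λ _ → mk⇔ (λ { (here e) → here e ; (there (here e)) → here e })
                            (λ { (here e) → here e }))
                 (proj₂ (revAsc x))
  ; avoid    = proj₂ (avoid x)
  }

compose : List ℕ → List ℕ → List ℕ
compose (a₀ ∷ [])      (b₀ ∷ bs) = b₀ ∷ b₀ ∷ bs
compose (a₀ ∷ a₁ ∷ as) (b₀ ∷ bs) = a₀ + b₀ ∷ b₀ ∷ map (_+ b₀) (a₁ ∷ as) ++ bs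
compose _              _         = []

compose-∷ : ∀ a₀ as b₀ bs → as ≢ [] → compose (a₀ ∷ as) (b₀ ∷ bs) ≡ a₀ + b₀ ∷ b₀ ∷ map (_+ b₀) as ++ bs
compose-∷ a₀ []      b₀ bs as≢[] = ⊥-elim (as≢[] refl)
compose-∷ a₀ (_ ∷ _) b₀ bs _     = refl

length-compose : ∀ a b → RevAsc213 a → RevAsc213 b → length (compose a b) ≡ length a + length b
length-compose (a₀ ∷ [])      (b₀ ∷ bs) _ _ = refl
length-compose (a₀ ∷ a₁ ∷ as) (b₀ ∷ bs) _ _ = cong (suc ∘ suc) (begin
  length (map (_+ b₀) (a₁ ∷ as) ++ bs)       ≡⟨ length-++ (map (_+ b₀) (a₁ ∷ as)) ⟩
  length (map (_+ b₀) (a₁ ∷ as)) + length bs ≡⟨ cong (_+ length bs) (length-map (_+ b₀) (a₁ ∷ as)) ⟩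
  suc (length as) + length bs                ≡⟨ sym (+-suc (length as) (length bs)) ⟩
  length as + suc (length bs)                ∎)
  where open ≡-Reasoning

compose-head : ∀ a₀ as b₀ bs {x₀ xs} → compose (a₀ ∷ as) (b₀ ∷ bs) ≡ x₀ ∷ xs → x₀ ≤ a₀ + b₀
compose-head a₀ []      b₀ bs refl = m≤n+m b₀ a₀
compose-head a₀ (_ ∷ _) b₀ bs refl = ≤-refl

decompose : List ℕ → List ℕ × List ℕ
decompose (x₀ ∷ x₁ ∷ r) with x₁ ≟ x₀
... | yes _ = [ 1 ] , x₁ ∷ r
... | no  _ = x₀ ∸ x₁ ∷ map (_∸ x₁) (takeWhile (x₁ <?_) r) , x₁ ∷ dropWhile (x₁ <?_) r
decompose _ = [] , []

module Glue {a₀ a₁ as b₀ bs} (a : IsRevAsc213 a₀ (a₁ ∷ as)) (b : IsRevAsc213 b₀ bs) where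

  U : List ℕ
  U = map (_+ b₀) (a₁ ∷ as)

  b₀<U : All (b₀ <_) U
  b₀<U = All.map⁺ (All.map (+-monoˡ-< b₀) (All.tail (positive a)))

  b₀<a₀+b₀ : b₀ < a₀ + b₀
  b₀<a₀+b₀ = +-monoˡ-< b₀ (All.head (positive a))

  b₀≮bs : Maybe.All (∁ (b₀ <_)) (head bs)
  b₀≮bs = All-head (All.map ≤⇒≯ (≤head b))

  glued-covers : Covers (a₀ + b₀) (a₀ + b₀ ∷ b₀ ∷ U ++ bs)
  glued-covers {i} i<a₀+b₀ with i <? b₀
  ... | yes i<b₀ with covers b i<b₀
  ...   | here e       = there (here e)
  ...   | there i∈bs   = there (there (Any.++⁺ʳ U i∈bs))
  glued-covers {i} i<a₀+b₀ | no i≮b₀ with ∈-map⁺ (_+ b₀) (covers a i∸b₀<a₀)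
    where
    i∸b₀<a₀ : i ∸ b₀ < a₀
    i∸b₀<a₀ = subst (i ∸ b₀ <_) (m+n∸n≡m a₀ b₀) (∸-monoˡ-< i<a₀+b₀ (≮⇒≥ i≮b₀))
  ... | i∈ rewrite m∸n+n≡m (≮⇒≥ i≮b₀) with i∈
  ...   | here e       = here e
  ...   | there i∈U    = there (there (Any.++⁺ˡ i∈U))

  private
    ctx : List ℕ
    ctx = a₀ + b₀ ∷ b₀ ∷ []

    shifted : ShiftedContext b₀ [ a₀ ] ctx (a₁ ∷ as)
    shifted {y} y∈ = mk⇔ down (λ { (here refl) → here refl })
      where
      down : y + b₀ ∈ ctx → y ∈ [ a₀ ]
      down (here e)         = here (+-cancelʳ-≡ b₀ y a₀ e)
      down (there (here e)) = ⊥-elim (<⇒≢ (+-monoˡ-< b₀ (All.lookup (All.tail (positive a)) y∈)) (sym e))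

    same : ∀ {z} → z ∈ bs → z ∈ [ b₀ ] ⇔ z ∈ ctx ++ U
    same {z} z∈bs = mk⇔ (λ { (here e) → there (here e) }) up
      where
      z≤b₀ : z ≤ b₀
      z≤b₀ = All.lookup (≤head b) z∈bs
      up : z ∈ ctx ++ U → z ∈ [ b₀ ]
      up (here e)          = ⊥-elim (<⇒≱ b₀<a₀+b₀ (subst (_≤ b₀) e z≤b₀))
      up (there (here e))  = here e
      up (there (there m)) = ⊥-elim (<⇒≱ (All.lookup b₀<U m) z≤b₀)

  glued-revAsc : RevAsc [ a₀ + b₀ ] (b₀ ∷ U ++ bs)
  glued-revAsc =
    mk⇔ (λ _ → All.head b₀<U) (λ _ → λ { (here e) → <⇒≢ b₀<a₀+b₀ e }) ,
    RevAsc-++⁺ ctx U bs (RevAsc-shift⁺ b₀ [ a₀ ] ctx (a₁ ∷ as) bs (≤head b) shifted (revAsc a))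
                        (RevAsc-cong [ b₀ ] (ctx ++ U) bs same (revAsc b))

  glued-avoid : Avoid213 (a₀ + b₀ ∷ b₀ ∷ U ++ bs)
  glued-avoid =
    No213At-≤ (a₀ + b₀) (b₀ ∷ U ++ bs)
      (m≤n+m b₀ a₀ ∷ All.++⁺ (All.map⁺ (All.map (+-monoˡ-≤ b₀) (≤head a)))
                             (All.map (λ z≤b₀ → ≤-trans z≤b₀ (m≤n+m b₀ a₀)) (≤head b))) ,
    No213At-++ b₀ U bs (No213At-≥ b₀ U (All.map <⇒≤ b₀<U)) (≤head b) ,
    Avoid213-++ U bs (Avoid213-+⁺ b₀ (a₁ ∷ as) (proj₂ (avoid a))) (proj₂ (avoid b))
      (All.map (λ b₀<y → All.map (λ z≤b₀ → ≤-trans z≤b₀ (<⇒≤ b₀<y)) (≤head b)) b₀<U)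

  glued : IsRevAsc213 (a₀ + b₀) (b₀ ∷ U ++ bs)
  glued = record
    { positive = ≤-trans (All.head (positive b)) (<⇒≤ b₀<a₀+b₀) ∷ All.head (positive b)
               ∷ All.++⁺ (All.map (λ b₀<y → ≤-trans (All.head (positive b)) (<⇒≤ b₀<y)) b₀<U)
                         (All.tail (positive b))
    ; covers   = glued-covers
    ; revAsc   = glued-revAsc
    ; avoid    = glued-avoid
    }

  decomposed : decompose (a₀ + b₀ ∷ b₀ ∷ U ++ bs) ≡ (a₀ ∷ a₁ ∷ as , b₀ ∷ bs)
  decomposed with b₀ ≟ a₀ + b₀
  ... | yes b₀≡a₀+b₀ = ⊥-elim (<⇒≢ b₀<a₀+b₀ b₀≡a₀+b₀)
  ... | no  _ rewrite takeWhile-++ (b₀ <?_) b₀<U b₀≮bs | dropWhile-++ (b₀ <?_) b₀<U b₀≮bs =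
    cong₂ (λ y l → y ∷ l , b₀ ∷ bs) (m+n∸n≡m a₀ b₀)
          (trans (sym (map-∘ (a₁ ∷ as))) (map-id-local (All.universal (λ y → m+n∸n≡m y b₀) (a₁ ∷ as))))

module Split {x₀ x₁ r} (x : IsRevAsc213 x₀ (x₁ ∷ r)) (x₁≢x₀ : x₁ ≢ x₀) where

  u v w : List ℕ
  u = takeWhile (x₁ <?_) r
  v = dropWhile (x₁ <?_) r
  w = map (_∸ x₁) u

  r≡u++v : r ≡ u ++ v
  r≡u++v = sym (takeWhile++dropWhile (x₁ <?_) r)

  x₁<u : All (x₁ <_) u
  x₁<u = All.all-takeWhile (x₁ <?_) r

  x₁<x₀ : x₁ < x₀
  x₁<x₀ = ≤∧≢⇒< (All.head (≤head x)) x₁≢x₀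

  u≡w+x₁ : u ≡ map (_+ x₁) w
  u≡w+x₁ = sym (trans (sym (map-∘ u)) (map-id-local (All.map (m∸n+n≡m ∘ <⇒≤) x₁<u)))

  private
    ctx : List ℕ
    ctx = x₀ ∷ x₁ ∷ []

    nub⇔asc : x₁ ∉ [ x₀ ] ⇔ Ascends x₁ r
    nub⇔asc = proj₁ (revAsc x)

    revAsc-u++v : RevAsc ctx (u ++ v)
    revAsc-u++v = subst (RevAsc ctx) r≡u++v (proj₂ (revAsc x))

    before : RevAscBefore ctx u v
    before = proj₁ (RevAsc-++⁻ ctx u v revAsc-u++v)

    after : RevAsc (ctx ++ u) v
    after = proj₂ (RevAsc-++⁻ ctx u v revAsc-u++v)

    x₀-no213 : No213At x₀ (u ++ v)
    x₀-no213 = subst (No213At x₀) r≡u++v (proj₂ (proj₁ (avoid x)))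

    x₁-no213 : No213At x₁ (u ++ v)
    x₁-no213 = subst (No213At x₁) r≡u++v (proj₁ (proj₂ (avoid x)))

    avoid-u++v : Avoid213 (u ++ v)
    avoid-u++v = subst Avoid213 r≡u++v (proj₂ (proj₂ (avoid x)))

  ¬x₁<v : ¬ Ascends x₁ v
  ¬x₁<v with v | All.all-head-dropWhile (x₁ <?_) r
  ... | []    | _             = λ ()
  ... | _ ∷ _ | Maybe.just ¬< = ¬<

  v≤x₁ : All (_≤ x₁) v
  v≤x₁ = RevAsc⇒below x₁ (ctx ++ u) v (there (here refl)) ¬x₁<v (No213At-++⁻ʳ x₁ u v x₁-no213) after

  private
    ∈-parts : ∀ {y} → y ∈ x₀ ∷ x₁ ∷ r → y ≡ x₀ ⊎ y ≡ x₁ ⊎ y ∈ u ⊎ y ∈ v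
    ∈-parts (here e)         = inj₁ e
    ∈-parts (there (here e)) = inj₂ (inj₁ e)
    ∈-parts (there (there m)) with Any.++⁻ u (subst (_ ∈_) r≡u++v m)
    ... | inj₁ m∈u = inj₂ (inj₂ (inj₁ m∈u))
    ... | inj₂ m∈v = inj₂ (inj₂ (inj₂ m∈v))

    +≡⇒≡∸ : ∀ {y c d} → y + c ≡ d → y ≡ d ∸ c
    +≡⇒≡∸ {y} {c} e = trans (sym (m+n∸n≡m y c)) (cong (_∸ c) e)

    same : ∀ {z} → z ∈ v → z ∈ ctx ++ u ⇔ z ∈ [ x₁ ]
    same {z} z∈v = mk⇔ down (λ { (here e) → there (here e) })
      where
      z≤x₁ : z ≤ x₁
      z≤x₁ = All.lookup v≤x₁ z∈v
      down : z ∈ ctx ++ u → z ∈ [ x₁ ]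
      down (here e)          = ⊥-elim (<⇒≱ x₁<x₀ (subst (_≤ x₁) e z≤x₁))
      down (there (here e))  = here e
      down (there (there m)) = ⊥-elim (<⇒≱ (All.lookup x₁<u m) z≤x₁)

    right-covers : Covers x₁ (x₁ ∷ v)
    right-covers {j} j<x₁ with ∈-parts (covers x (<-trans j<x₁ x₁<x₀))
    ... | inj₁ e                = ⊥-elim (<⇒≱ x₁<x₀ (subst (_≤ x₁) e j<x₁))
    ... | inj₂ (inj₁ e)         = here e
    ... | inj₂ (inj₂ (inj₁ m))  = ⊥-elim (<⇒≱ (All.lookup x₁<u m) j<x₁)
    ... | inj₂ (inj₂ (inj₂ m))  = there m

  right : IsRevAsc213 x₁ v
  right = record
    { positive = All.head (All.tail (positive x))
               ∷ All.++⁻ʳ u (subst (All (0 <_)) r≡u++v (All.tail (All.tail (positive x))))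
    ; covers   = right-covers
    ; revAsc   = RevAsc-cong (ctx ++ u) [ x₁ ] v same after
    ; avoid    = No213At-++⁻ʳ x₁ u v x₁-no213 , Avoid213-++⁻ʳ u v avoid-u++v
    }

  private
    x₀∸x₁+x₁ : x₀ ∸ x₁ + x₁ ≡ x₀
    x₀∸x₁+x₁ = m∸n+n≡m (<⇒≤ x₁<x₀)

    0<w : All (0 <_) w
    0<w = All.map⁺ (All.map m<n⇒0<n∸m x₁<u)

    shifted : ShiftedContext x₁ [ x₀ ∸ x₁ ] ctx w
    shifted {y} y∈w = mk⇔ down (λ { (here refl) → here x₀∸x₁+x₁ })
      where
      down : y + x₁ ∈ ctx → y ∈ [ x₀ ∸ x₁ ]
      down (here e)         = here (+≡⇒≡∸ e)
      down (there (here e)) = ⊥-elim (<⇒≢ (+-monoˡ-< x₁ (All.lookup 0<w y∈w)) (sym e))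

    left-covers : Covers (x₀ ∸ x₁) (x₀ ∸ x₁ ∷ w)
    left-covers {j} j<x₀∸x₁ with ∈-parts (covers x j+x₁<x₀)
      where
      j+x₁<x₀ : j + x₁ < x₀
      j+x₁<x₀ = subst (j + x₁ <_) x₀∸x₁+x₁ (+-monoˡ-< x₁ j<x₀∸x₁)
    ... | inj₁ e                = here (+≡⇒≡∸ e)
    ... | inj₂ (inj₁ e)         = ⊥-elim (<⇒≢ (+-monoˡ-< x₁ (s≤s (z≤n {j}))) (sym e))
    ... | inj₂ (inj₂ (inj₁ m))  = there (subst (_∈ w) (m+n∸n≡m (suc j) x₁) (∈-map⁺ (_∸ x₁) m))
    ... | inj₂ (inj₂ (inj₂ m))  = ⊥-elim (<⇒≱ (+-monoˡ-< x₁ (s≤s (z≤n {j}))) (All.lookup v≤x₁ m))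

  left : IsRevAsc213 (x₀ ∸ x₁) w
  left = record
    { positive = m<n⇒0<n∸m x₁<x₀ ∷ 0<w
    ; covers   = left-covers
    ; revAsc   = RevAsc-shift⁻ x₁ [ x₀ ∸ x₁ ] ctx w v v≤x₁ shifted
                   (subst (λ l → RevAscBefore ctx l v) u≡w+x₁ before)
    ; avoid    = Avoid213-+⁻ x₁ (x₀ ∸ x₁ ∷ w)
                   (subst Avoid213 (cong₂ _∷_ (sym x₀∸x₁+x₁) u≡w+x₁)
                      (No213At-++⁻ˡ x₀ u v x₀-no213 , Avoid213-++⁻ˡ u v avoid-u++v))
    }

  w≢[] : w ≢ []
  w≢[] w≡[] = ¬x₁<v (subst (Ascends x₁) (trans r≡u++v (cong (_++ v) (map-≡[] w≡[]))) x₁<r)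
    where
    x₁<r : Ascends x₁ r
    x₁<r = to nub⇔asc (λ { (here x₁≡x₀) → x₁≢x₀ x₁≡x₀ })
    map-≡[] : ∀ {xs : List ℕ} → map (_∸ x₁) xs ≡ [] → xs ≡ []
    map-≡[] {[]} _ = refl

  composed : compose (x₀ ∸ x₁ ∷ w) (x₁ ∷ v) ≡ x₀ ∷ x₁ ∷ r
  composed = begin
    compose (x₀ ∸ x₁ ∷ w) (x₁ ∷ v)         ≡⟨ compose-∷ (x₀ ∸ x₁) w x₁ v w≢[] ⟩
    x₀ ∸ x₁ + x₁ ∷ x₁ ∷ map (_+ x₁) w ++ v ≡⟨ cong₂ (λ y l → y ∷ x₁ ∷ l ++ v) x₀∸x₁+x₁ (sym u≡w+x₁) ⟩
    x₀ ∷ x₁ ∷ u ++ v                       ≡⟨ cong (λ l → x₀ ∷ x₁ ∷ l) (sym r≡u++v) ⟩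
    x₀ ∷ x₁ ∷ r                            ∎
    where open ≡-Reasoning

compose-RevAsc213 : ∀ a b → RevAsc213 a → RevAsc213 b → RevAsc213 (compose a b)
compose-RevAsc213 (a₀ ∷ [])      (b₀ ∷ bs) _ b = repeat-head b
compose-RevAsc213 (a₀ ∷ a₁ ∷ as) (b₀ ∷ bs) a b = Glue.glued a b

decompose-RevAsc213 : ∀ {x₀ x₁ r} → IsRevAsc213 x₀ (x₁ ∷ r) →
                      RevAsc213 (proj₁ (decompose (x₀ ∷ x₁ ∷ r))) ×
                      RevAsc213 (proj₂ (decompose (x₀ ∷ x₁ ∷ r)))
decompose-RevAsc213 {x₀} {x₁} x with x₁ ≟ x₀
... | yes refl  = one , drop-repeat x
... | no  x₁≢x₀ = Split.left x x₁≢x₀ , Split.right x x₁≢x₀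

compose-decompose : ∀ {x₀ x₁ r} → IsRevAsc213 x₀ (x₁ ∷ r) →
                    uncurry compose (decompose (x₀ ∷ x₁ ∷ r)) ≡ x₀ ∷ x₁ ∷ r
compose-decompose {x₀} {x₁} x with x₁ ≟ x₀
... | yes refl  = refl
... | no  x₁≢x₀ = Split.composed x x₁≢x₀

decompose-compose : ∀ a b → RevAsc213 a → RevAsc213 b → decompose (compose a b) ≡ (a , b)
decompose-compose (a₀ ∷ []) (b₀ ∷ bs) a _ with b₀ ≟ b₀
... | yes _     = cong (λ c → [ c ] , b₀ ∷ bs) (sym (singleton≡1 a))
... | no  b₀≢b₀ = ⊥-elim (b₀≢b₀ refl)
decompose-compose (_ ∷ _ ∷ _) (_ ∷ _) a b = Glue.decomposed a b

decomposition : ∀ {x₀ x₁ r} → IsRevAsc213 x₀ (x₁ ∷ r) →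
                ∃ λ a → ∃ λ b → RevAsc213 a × RevAsc213 b × compose a b ≡ x₀ ∷ x₁ ∷ r
decomposition x = let a , b = decompose-RevAsc213 x in _ , _ , a , b , compose-decompose x

suc+suc-injective : ∀ {p q m} → suc p + suc q ≡ suc (suc m) → p + q ≡ m
suc+suc-injective {p} {q} e = suc-injective (trans (sym (+-suc p q)) (suc-injective e))

-- x₀ is at most the length, by induction along the decomposition: the head of
-- compose a b is at most the sum of the heads, and the lengths add up.
head≤length : ∀ n {x₀ xs} → length xs ≤ n → IsRevAsc213 x₀ xs → x₀ ≤ suc (length xs)
head≤length n       {xs = []}     _         x = ≤-reflexive (singleton≡1 x)
head≤length (suc n) {x₀} {x₁ ∷ r} (s≤s |r|≤n) x with decomposition x
... | a₀ ∷ as , b₀ ∷ bs , a , b , composed = begin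
  x₀                                ≤⟨ compose-head a₀ as b₀ bs composed ⟩
  a₀ + b₀                           ≤⟨ +-mono-≤ (head≤length n (≤-trans (m≤m+n _ _) |as|+|bs|≤n) a)
                                                (head≤length n (≤-trans (m≤n+m _ _) |as|+|bs|≤n) b) ⟩
  suc (length as) + suc (length bs) ≡⟨ lengths ⟩
  suc (suc (length r))              ∎
  where
  open ≤-Reasoning
  lengths : suc (length as) + suc (length bs) ≡ suc (suc (length r))
  lengths = trans (sym (length-compose (a₀ ∷ as) (b₀ ∷ bs) a b)) (cong length composed)
  |as|+|bs|≤n : length as + length bs ≤ n
  |as|+|bs|≤n = subst (_≤ n) (sym (suc+suc-injective lengths)) |r|≤n
... | []    , _     , () , _
... | _ ∷ _ , []    , _  , () , _

entries≤length : ∀ {x₀ xs} → IsRevAsc213 x₀ xs → All (_≤ suc (length xs)) (x₀ ∷ xs)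
entries≤length {xs = xs} x = x₀≤ ∷ All.map (λ y≤x₀ → ≤-trans y≤x₀ x₀≤) (≤head x)
  where
  x₀≤ = head≤length (length xs) ≤-refl x


-- Counting

InRange : ℕ → ℕ → Set
InRange m v = 0 < v × v ≤ m

∈-words⁻ : ∀ m k {x} → x ∈ words m k → length x ≡ k × All (InRange m) x
∈-words⁻ m zero    (here refl) = refl , []
∈-words⁻ m (suc k) x∈ with find (∈-concatMap⁻ (λ a → map (a ∷_) (words m k)) {xs = map suc (upTo m)} x∈)
... | a , a∈ , x∈′ with ∈-map⁻ suc a∈ | ∈-map⁻ (a ∷_) x∈′
... | i , i∈ , refl | y , y∈ , refl with ∈-words⁻ m k y∈
... | len , range = cong suc len , (s≤s z≤n , ∈-upTo⁻ i∈) ∷ range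

∈-words⁺ : ∀ m k {x} → length x ≡ k → All (InRange m) x → x ∈ words m k
∈-words⁺ m zero    {[]}        _   _                      = here refl
∈-words⁺ m (suc k) {suc i ∷ x} len ((_ , suc-i≤m) ∷ range) =
  ∈-concatMap⁺ (λ a → map (a ∷_) (words m k)) (Any.map⁺ (lose (∈-upTo⁺ suc-i≤m)
                                (∈-map⁺ (suc i ∷_) (∈-words⁺ m k (suc-injective len) range))))

words-unique : ∀ m k → Unique (words m k)
words-unique m zero    = [] ∷ []
words-unique m (suc k) =
  Unique-concatMap (λ a → map (a ∷_) (words m k)) (Unique.map⁺ suc-injective (Unique.upTo⁺ m))
    (λ a → Unique.map⁺ ∷-injectiveʳ (words-unique m k)) disjoint
  where
  disjoint : ∀ {a a′} → a ≢ a′ → Disjoint (map (a ∷_) (words m k)) (map (a′ ∷_) (words m k))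
  disjoint a≢a′ (x∈ , x∈′) with ∈-map⁻ _ x∈ | ∈-map⁻ _ x∈′
  ... | _ , _ , refl | _ , _ , e = a≢a′ (∷-injectiveˡ e)

B213 : ℕ → List (List ℕ)
B213 n = filter (λ x → T? (isRevisedAscent x ∧ avoids x (2 ∷ 1 ∷ 3 ∷ []))) (endofunctions n)

B213-unique : ∀ n → Unique (B213 n)
B213-unique n = Unique.filter⁺ _ (words-unique n n)

T-B213 : ∀ x₀ xs → All (0 <_) (x₀ ∷ xs) →
         T (isRevisedAscent (x₀ ∷ xs) ∧ avoids (x₀ ∷ xs) (2 ∷ 1 ∷ 3 ∷ [])) ⇔ IsRevAsc213 x₀ xs
T-B213 x₀ xs positive = mk⇔
  (λ t → let ra , av = to T-∧ t ; rev , cov = to (T-isRevisedAscent x₀ xs) ra in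
         record { positive = positive ; covers = cov ; revAsc = rev ; avoid = to (T-avoids213 (x₀ ∷ xs)) av })
  (λ x → from T-∧ ( from (T-isRevisedAscent x₀ xs) (revAsc x , covers x)
                   , from (T-avoids213 (x₀ ∷ xs)) (avoid x)))

∈-B213⁻ : ∀ n {x} → x ∈ B213 (suc n) → length x ≡ suc n × RevAsc213 x
∈-B213⁻ n {x} x∈ with ∈-filter⁻ (λ x → T? (isRevisedAscent x ∧ avoids x (2 ∷ 1 ∷ 3 ∷ [])))
                                {xs = endofunctions (suc n)} x∈
∈-B213⁻ n {x₀ ∷ xs} x∈ | x∈words , t with ∈-words⁻ (suc n) (suc n) x∈words
... | len , range = len , to (T-B213 x₀ xs (All.map proj₁ range)) t
∈-B213⁻ n {[]}      x∈ | x∈words , _ with ∈-words⁻ (suc n) (suc n) x∈words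
... | () , _

∈-B213⁺ : ∀ n {x} → length x ≡ suc n → RevAsc213 x → x ∈ B213 (suc n)
∈-B213⁺ n {x₀ ∷ xs} len x =
  ∈-filter⁺ (λ x → T? (isRevisedAscent x ∧ avoids x (2 ∷ 1 ∷ 3 ∷ [])))
    (∈-words⁺ (suc n) (suc n) len
       (All.zipWith (λ {y} (0<y , y≤) → 0<y , subst (y ≤_) len y≤) (positive x , entries≤length x)))
    (from (T-B213 x₀ xs (positive x)) x)

pairsAt : ℕ → ℕ → List (List ℕ × List ℕ)
pairsAt m i = cartesianProduct (B213 (suc (m ∸ i))) (B213 (suc i))

-- The pairs (a , b) in B̂(213) × B̂(213) with |a| + |b| = m + 2, grouped by |b| = i + 1.
pairs : ℕ → List (List ℕ × List ℕ)
pairs m = concatMap (pairsAt m) (upTo (suc m))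

∈-pairs⁻ : ∀ m {a b} → (a , b) ∈ pairs m →
           RevAsc213 a × RevAsc213 b × length a + length b ≡ suc (suc m)
∈-pairs⁻ m {a} {b} ab∈ with find (∈-concatMap⁻ (pairsAt m) {xs = upTo (suc m)} ab∈)
... | i , i∈ , ab∈ᵢ with ∈-cartesianProduct⁻ (B213 (suc (m ∸ i))) (B213 (suc i)) ab∈ᵢ
... | a∈ , b∈ with ∈-B213⁻ (m ∸ i) a∈ | ∈-B213⁻ i b∈
... | |a| , ra | |b| , rb = ra , rb , (begin
  length a + length b   ≡⟨ cong₂ _+_ |a| |b| ⟩
  suc (m ∸ i) + suc i   ≡⟨ cong suc (+-suc (m ∸ i) i) ⟩
  suc (suc (m ∸ i + i)) ≡⟨ cong (suc ∘ suc) (m∸n+n≡m (≤-pred (∈-upTo⁻ i∈))) ⟩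
  suc (suc m)           ∎)
  where open ≡-Reasoning

∈-pairs⁺ : ∀ m {a b} → RevAsc213 a → RevAsc213 b → length a + length b ≡ suc (suc m) → (a , b) ∈ pairs m
∈-pairs⁺ m {a₀ ∷ as} {b₀ ∷ bs} ra rb len =
  ∈-concatMap⁺ (pairsAt m)
    (lose (∈-upTo⁺ (s≤s |bs|≤m))
          (∈-cartesianProduct⁺ (∈-B213⁺ (m ∸ length bs) (cong suc (sym m∸|bs|≡|as|)) ra)
                               (∈-B213⁺ (length bs) refl rb)))
  where
  |as|+|bs|≡m : length as + length bs ≡ m
  |as|+|bs|≡m = suc+suc-injective len
  |bs|≤m : length bs ≤ m
  |bs|≤m = subst (length bs ≤_) |as|+|bs|≡m (m≤n+m (length bs) (length as))
  m∸|bs|≡|as| : m ∸ length bs ≡ length as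
  m∸|bs|≡|as| = trans (cong (_∸ length bs) (sym |as|+|bs|≡m)) (m+n∸n≡m (length as) (length bs))

pairs-unique : ∀ m → Unique (pairs m)
pairs-unique m = Unique-concatMap (pairsAt m) (Unique.upTo⁺ (suc m))
  (λ i → Unique.cartesianProduct⁺ (B213-unique (suc (m ∸ i))) (B213-unique (suc i))) disjoint
  where
  |b| : ∀ {k a b} → (a , b) ∈ pairsAt m k → length b ≡ suc k
  |b| {k} ab∈ = proj₁ (∈-B213⁻ k (proj₂ (∈-cartesianProduct⁻ (B213 (suc (m ∸ k))) (B213 (suc k)) ab∈)))
  disjoint : ∀ {i j} → i ≢ j → Disjoint (pairsAt m i) (pairsAt m j)
  disjoint i≢j (ab∈ᵢ , ab∈ⱼ) = i≢j (suc-injective (trans (sym (|b| ab∈ᵢ)) (|b| ab∈ⱼ)))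

∈-map-compose⁺ : ∀ m {x} → x ∈ B213 (suc (suc m)) → x ∈ map (uncurry compose) (pairs m)
∈-map-compose⁺ m {x₀ ∷ x₁ ∷ r} x∈ =
  let len , x = ∈-B213⁻ (suc m) x∈ ; a , b , ra , rb , composed = decomposition x in
  subst (_∈ map (uncurry compose) (pairs m)) composed
    (∈-map⁺ (uncurry compose)
       (∈-pairs⁺ m ra rb (trans (sym (length-compose a b ra rb)) (trans (cong length composed) len))))
∈-map-compose⁺ m {[]}     x∈ with () ← proj₁ (∈-B213⁻ (suc m) x∈)
∈-map-compose⁺ m {_ ∷ []} x∈ with () ← proj₁ (∈-B213⁻ (suc m) x∈)

∈-map-compose⁻ : ∀ m {x} → x ∈ map (uncurry compose) (pairs m) → x ∈ B213 (suc (suc m))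
∈-map-compose⁻ m x∈ =
  let (a , b) , ab∈ , x≡ = ∈-map⁻ (uncurry compose) x∈ ; ra , rb , len = ∈-pairs⁻ m ab∈ in
  subst (_∈ B213 (suc (suc m))) (sym x≡)
    (∈-B213⁺ (suc m) (trans (length-compose a b ra rb) len) (compose-RevAsc213 a b ra rb))

decompose-compose-pairs : ∀ m → All (λ ab → decompose (uncurry compose ab) ≡ ab) (pairs m)
decompose-compose-pairs m = All.tabulate inverse
  where
  inverse : ∀ {ab} → ab ∈ pairs m → decompose (uncurry compose ab) ≡ ab
  inverse {a , b} ab∈ = let ra , rb , _ = ∈-pairs⁻ m ab∈ in decompose-compose a b ra rb

|B213| : ℕ → ℕ
|B213| j = length (B213 (suc j))

B213-recurrence : ∀ m → |B213| (suc m) ≡ sum (map (λ i → |B213| (m ∸ i) * |B213| i) (upTo (suc m)))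
B213-recurrence m = begin
  |B213| (suc m)
    ≡⟨ length-bijection (uncurry compose) decompose (pairs-unique m) (B213-unique (suc (suc m)))
         (decompose-compose-pairs m) (mk⇔ (∈-map-compose⁺ m) (∈-map-compose⁻ m)) ⟩
  length (pairs m)
    ≡⟨ length-concatMap (pairsAt m) (upTo (suc m)) ⟩
  sum (map (length ∘ pairsAt m) (upTo (suc m)))
    ≡⟨ cong sum (map-cong (λ i → length-cartesianProduct (B213 (suc (m ∸ i))) (B213 (suc i))) (upTo (suc m))) ⟩
  sum (map (λ i → |B213| (m ∸ i) * |B213| i) (upTo (suc m))) ∎
  where open ≡-Reasoning

convolution : ∀ (c : ℕ → ℕ) m →
              sum (zipWith _*_ (map c (downFrom (suc m))) (reverse (map c (downFrom (suc m))))) ≡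
              sum (map (λ i → c (m ∸ i) * c i) (upTo (suc m)))
convolution c m = cong sum (begin
  zipWith _*_ (map c (downFrom (suc m))) (reverse (map c (downFrom (suc m))))
    ≡⟨ cong (λ cs → zipWith _*_ cs (reverse cs)) (map-downFrom c (suc m)) ⟩
  zipWith _*_ (applyDownFrom c (suc m)) (reverse (applyDownFrom c (suc m)))
    ≡⟨ cong₂ (zipWith _*_) (applyDownFrom-suc c m) (reverse-applyDownFrom c (suc m)) ⟩
  zipWith _*_ (applyUpTo (λ i → c (m ∸ i)) (suc m)) (applyUpTo c (suc m))
    ≡⟨ zipWith-applyUpTo _*_ (λ i → c (m ∸ i)) c (suc m) ⟩
  applyUpTo (λ i → c (m ∸ i) * c i) (suc m)
    ≡⟨ sym (map-applyUpTo (λ i → i) (λ i → c (m ∸ i) * c i) (suc m)) ⟩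
  map (λ i → c (m ∸ i) * c i) (upTo (suc m)) ∎)
  where open ≡-Reasoning

B213-step : ∀ m → map |B213| (downFrom (suc m)) ≡ catalans m →
            |B213| (suc m) ≡ sum (zipWith _*_ (catalans m) (reverse (catalans m)))
B213-step m ih = begin
  |B213| (suc m)                                             ≡⟨ B213-recurrence m ⟩
  sum (map (λ i → |B213| (m ∸ i) * |B213| i) (upTo (suc m))) ≡⟨ sym (convolution |B213| m) ⟩
  sum (zipWith _*_ cs (reverse cs))                          ≡⟨ cong (λ l → sum (zipWith _*_ l (reverse l))) ih ⟩
  sum (zipWith _*_ (catalans m) (reverse (catalans m)))      ∎
  where
  open ≡-Reasoning
  cs : List ℕ
  cs = map |B213| (downFrom (suc m))

catalans-B213 : ∀ m → map |B213| (downFrom (suc m)) ≡ catalans m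
catalans-B213 zero    = refl
catalans-B213 (suc m) = cong₂ _∷_ (B213-step m (catalans-B213 m)) (catalans-B213 m)

mainTheorem8 : (n : ℕ) → countB (suc n) (2 ∷ 1 ∷ 3 ∷ []) ≡ catalan n
mainTheorem8 zero    = refl
mainTheorem8 (suc m) = B213-step m (catalans-B213 m)
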